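{- Let $\lambda\ge\mu\ge 4$ and $n=\lambda\mu$. Then $(C_\lambda\times C_\mu)(s_1,\dots,s_n)\in\mathscr{C}_0$ for all integers $s_1,\dots,s_n\ge 2$.
   Context: $C_k$ is the cycle of length $k$. The cartesian product $G\times H$ has vertex set $V(G)\times V(H)$, with $\langle u,x\rangle\langle v,y\rangle$ an edge iff either $u=v$ and $xy\in E(H)$, or $uv\in E(G)$ and $x=y$. For a graph $G$ with vertex set $\{v_1,\dots,v_n\}$ and positive integers $s_1,\dots,s_n$, the vertex-multiplication $G(s_1,\dots,s_n)$ is the graph whose vertex set is a disjoint union $V_1\cup\dots\cup V_n$ with $|V_i|=s_i$, where $u\in V_i$ and $v\in V_j$ are adjacent iff $i\ne j$ and $v_iv_j\in E(G)$. For a connected bridgeless graph $X$, $\bar d(X)$ is the minimum diameter of a strong orientation of $X$. $\mathscr{C}_0$ is the class of vertex-multiplications $G(s_1,\dots,s_n)$ of a connected graph $G$ with all $s_i\ge 2$ such that $\bar d(G(s_1,\dots,s_n))=d(G)$, $d(G)$ the diameter of $G$. -}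

module Defs where

open import Data.Nat using (ℕ; zero; suc; _≤_)
open import Data.Fin using (Fin; toℕ)
open import Data.Product using (Σ; ∃; _×_; _,_)
open import Data.Sum using (_⊎_)
open import Relation.Binary.PropositionalEquality using (_≡_)
open import Relation.Nullary using (¬_)

record Graph : Set₁ where
  field
    V : Set
    E : V → V → Set
open Graph public

data WalkLe {V : Set} (R : V → V → Set) : ℕ → V → V → Set where
  here : ∀ {k u} → WalkLe R k u u
  step : ∀ {k u w v} → R u w → WalkLe R k w v → WalkLe R (suc k) u v

Connected : {V : Set} → (V → V → Set) → Set
Connected {V} R = (u v : V) → ∃ λ k → WalkLe R k u v

DiamLe : {V : Set} → (V → V → Set) → ℕ → Set
DiamLe {V} R k = (u v : V) → WalkLe R k u v

IsDiameter : {V : Set} → (V → V → Set) → ℕ → Set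
IsDiameter R D = DiamLe R D × ((k : ℕ) → DiamLe R k → D ≤ k)

IsOrientation : (G : Graph) → (V G → V G → Set) → Set
IsOrientation G O =
  ((u v : V G) → O u v → E G u v) ×
  ((u v : V G) → E G u v → O u v ⊎ O v u) ×
  ((u v : V G) → ¬ (O u v × O v u))

IsMinOrientDiam : Graph → ℕ → Set₁
IsMinOrientDiam G D =
  (Σ (V G → V G → Set) λ O → IsOrientation G O × Connected O × DiamLe O D) ×
  ((O : V G → V G → Set) → IsOrientation G O → Connected O →
     (k : ℕ) → DiamLe O k → D ≤ k)

NextC : (k : ℕ) → Fin k → Fin k → Set
NextC k i j = (suc (toℕ i) ≡ toℕ j) ⊎ ((suc (toℕ i) ≡ k) × (toℕ j ≡ 0))

Cycle : ℕ → Graph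
Cycle k = record { V = Fin k ; E = λ i j → NextC k i j ⊎ NextC k j i }

_□_ : Graph → Graph → Graph
G □ H = record
  { V = V G × V H
  ; E = λ { (u , x) (v , y) → ((u ≡ v) × E H x y) ⊎ (E G u v × (x ≡ y)) } }

VMult : (G : Graph) → (V G → ℕ) → Graph
VMult G s = record
  { V = Σ (V G) (λ v → Fin (s v))
  ; E = λ { (i , a) (j , b) → (¬ (i ≡ j)) × E G i j } }

InC0 : (G : Graph) → (V G → ℕ) → Set₁
InC0 G s =
  Connected (E G) ×
  ((v : V G) → 2 ≤ s v) ×
  (Σ ℕ λ D → IsDiameter (E G) D × IsMinOrientDiam (VMult G s) D)

module Submission where

-- Orient G(s) through an antisymmetric weight w : E(G) → Z/2: the arc (x, a) → (y, b) is present
-- iff bit b = bit a + w(x, y), where bit separates copy 0 from the other copies. A walk of G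
-- with weight π then lifts to directed walks from (x, a) to every (y, b) with bit b = bit a + π,
-- so d(G(s)) ≤ D as soon as any two vertices of G are joined by walks of both weights of
-- length between 1 and D; conversely every oriented walk projects to a walk of G, so no
-- orientation beats d(G). On C_λ × C_μ, D = ⌊λ/2⌋ + ⌊μ/2⌋ = d(G). A shortest walk that is
-- two steps short of D is corrected by a back-and-forth detour; otherwise the displacement is
-- nearly antipodal, and the weights are chosen so that the rectangle spanned by the two
-- shortest cycle routes (or by a short and a long one, when one side is thin) contains a unit
-- square of odd weight: going around it by either side gives both parities.

open import Defs
open import Data.Nat using (ℕ; zero; suc; pred; ≤-pred; ⌊_/2⌋; _+_; _∸_; _⊓_; _%_; _≤_; _<_; z≤n; s≤s; NonZero; >-nonZero; _≡ᵇ_; _≟_; _≤?_; _<?_)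
open import Data.Nat.DivMod using (m%n<n; %-distribˡ-+; n%n≡0; m<n⇒m%n≡m; [m+n]%n≡m%n)
open import Data.Nat.Properties
open import Function using (_∘_)
open import Data.Fin using (Fin; toℕ; fromℕ<)
open import Data.Fin.Properties using (toℕ-fromℕ<; toℕ-injective; toℕ<n)
open import Data.Bool using (Bool; true; false; not; _xor_; _∧_; _∨_)
open import Data.Bool.Properties using (¬-not; xor-assoc; xor-comm; xor-same; xor-identityʳ; xor-inverseʳ; xor-annihilates-not; not-involutive; xor-∧-commutativeRing)
open import Data.Product using (_×_; _,_; Σ; ∃; proj₁; proj₂)
open import Data.Sum using (_⊎_; inj₁; inj₂)
import Data.Sum
open import Relation.Nullary using (¬_; Dec; yes; no; contradiction)
open import Relation.Nullary.Decidable using (_⊎-dec_; _×-dec_)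
open import Data.Nat.Tactic.RingSolver using (solve-∀)
open import Algebra.Bundles using (CommutativeRing)
open import Algebra.Properties.CommutativeSemigroup (CommutativeRing.+-commutativeSemigroup xor-∧-commutativeRing) using (interchange)
open import Relation.Binary.PropositionalEquality using (_≡_; _≢_; refl; sym; trans; cong; cong₂; subst; subst₂; module ≡-Reasoning)

odd : ℕ → Bool
odd zero = false
odd (suc n) = not (odd n)

xor-cancelˡ : ∀ a b → a xor (a xor b) ≡ b
xor-cancelˡ a b = trans (sym (xor-assoc a a b)) (cong (_xor b) (xor-same a))

xor-cancelʳ : ∀ a b → (a xor b) xor b ≡ a
xor-cancelʳ a b = trans (xor-assoc a b b) (trans (cong (a xor_) (xor-same b)) (xor-identityʳ a))

WalkLe-weaken : ∀ {V : Set} {R : V → V → Set} {k k' u v} → k ≤ k' → WalkLe R k u v → WalkLe R k' u v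
WalkLe-weaken k≤k' here = here
WalkLe-weaken (s≤s k≤k') (step r W) = step r (WalkLe-weaken k≤k' W)

WalkLe-map : ∀ {V V' : Set} {R : V → V → Set} {R' : V' → V' → Set} (f : V → V') →
  (∀ {u v} → R u v → R' (f u) (f v)) → ∀ {k u v} → WalkLe R k u v → WalkLe R' k (f u) (f v)
WalkLe-map f f-hom here = here
WalkLe-map f f-hom (step r W) = step (f-hom r) (WalkLe-map f f-hom W)

WalkLe-potential : ∀ {V : Set} {R : V → V → Set} (φ : V → ℕ) → (∀ {u v} → R u v → φ v ≤ suc (φ u)) →
  ∀ {k u v} → WalkLe R k u v → φ v ≤ k + φ u
WalkLe-potential φ φ-step {k} here = m≤n+m _ k
WalkLe-potential φ φ-step (step {k = k} {u = u} r W) = begin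
  _             ≤⟨ WalkLe-potential φ φ-step W ⟩
  k + φ _       ≤⟨ +-monoʳ-≤ k (φ-step r) ⟩
  k + suc (φ u) ≡⟨ +-suc k (φ u) ⟩
  suc k + φ u   ∎
  where open ≤-Reasoning

module ParityWalks (G : Graph) (w : V G → V G → Bool) where

  infixr 5 _∷_ _++_

  data ParityWalk : ℕ → Bool → V G → V G → Set where
    []  : ∀ {x} → ParityWalk 0 false x x
    _∷_ : ∀ {n π x y z} → E G x y → ParityWalk n π y z → ParityWalk (suc n) (w x y xor π) x z

  cast : ∀ {m n π ρ x y} → m ≡ n → π ≡ ρ → ParityWalk m π x y → ParityWalk n ρ x y
  cast refl refl W = W

  _++_ : ∀ {m n α β x y z} → ParityWalk m α x y → ParityWalk n β y z → ParityWalk (m + n) (α xor β) x z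
  [] ++ W' = W'
  _∷_ {π = π} {x} {y} e W ++ W' = cast refl (sym (xor-assoc (w x y) π _)) (e ∷ (W ++ W'))

  castEnds : ∀ {n π x x' y y'} → x ≡ x' → y ≡ y' → ParityWalk n π x y → ParityWalk n π x' y'
  castEnds refl refl W = W

  forget : ∀ {n π x y} → ParityWalk n π x y → WalkLe (E G) n x y
  forget [] = here
  forget (e ∷ W) = step e (forget W)

  BothParities : ℕ → V G → V G → Set
  BothParities n x y = ∀ π → ParityWalk n π x y

  BothParities-intro : ∀ {n α β x y} → α xor β ≡ true →
    ParityWalk n α x y → ParityWalk n β x y → BothParities n x y
  BothParities-intro {α = α} {β} α+β≡1 Wα Wβ π with α Data.Bool.≟ π
  ... | yes refl = Wα
  ... | no  α≢π  = cast refl (other α β π α+β≡1 α≢π) Wβ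
    where
    other : ∀ a b c → a xor b ≡ true → a ≢ c → b ≡ c
    other true  false false _ _ = refl
    other false true  true  _ _ = refl
    other true  false true  _ a≢c = contradiction refl a≢c
    other false true  false _ a≢c = contradiction refl a≢c

  prepend : ∀ {m n α x y z} → ParityWalk m α x y → BothParities n y z → BothParities (m + n) x z
  prepend {α = α} W B π = cast refl (xor-cancelˡ α π) (W ++ B (α xor π))

  append : ∀ {m n β x y z} → BothParities m x y → ParityWalk n β y z → BothParities (m + n) x z
  append {β = β} B W π = cast refl (xor-cancelʳ π β) (B (π xor β) ++ W)

  module Reversal (E-sym : ∀ {x y} → E G x y → E G y x)
                  (w-anti : ∀ {x y} → E G x y → w y x ≡ not (w x y)) where

    reverse : ∀ {n π x y} → ParityWalk n π x y → ParityWalk n (π xor odd n) y x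
    reverse [] = []
    reverse {suc n} (_∷_ {π = π} {x} {y} e W) =
      cast (+-comm n 1) (trans (cong (λ c → (π xor odd n) xor (c xor false)) (w-anti e)) (parity (w x y) π (odd n)))
        (reverse W ++ E-sym e ∷ [])
      where
      parity : ∀ c p o → (p xor o) xor (not c xor false) ≡ (c xor p) xor not o
      parity true  true  true  = refl
      parity true  true  false = refl
      parity true  false true  = refl
      parity true  false false = refl
      parity false true  true  = refl
      parity false true  false = refl
      parity false false true  = refl
      parity false false false = refl

    reverse-both : ∀ {n x y} → BothParities n x y → BothParities n y x
    reverse-both {n} B π = cast refl (xor-cancelʳ π (odd n)) (reverse (B (π xor odd n)))

orientation-walk-projects : ∀ (G : Graph) (s : V G → ℕ) {O} → IsOrientation (VMult G s) O →
  ∀ {k u v} → WalkLe O k u v → WalkLe (E G) k (proj₁ u) (proj₁ v)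
orientation-walk-projects G s (O⊆E , _ , _) = WalkLe-map proj₁ (λ r → proj₂ (O⊆E _ _ r))

module ParityOrientation (G : Graph) (w : V G → V G → Bool)
  (E-sym : ∀ {x y} → E G x y → E G y x) (E-irrefl : ∀ {x} → ¬ E G x x)
  (w-anti : ∀ {x y} → E G x y → w y x ≡ not (w x y))
  (s : V G → ℕ) (2≤s : ∀ v → 2 ≤ s v) where

  open ParityWalks G w

  copyBit : ∀ {n} → Fin n → Bool
  copyBit a = not (toℕ a ≡ᵇ 0)

  copyWithBit : ∀ v β → Σ (Fin (s v)) λ c → copyBit c ≡ β
  copyWithBit v false = fromℕ< 0<s , cong (λ t → not (t ≡ᵇ 0)) (toℕ-fromℕ< 0<s)
    where 0<s = ≤-trans (s≤s z≤n) (2≤s v)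
  copyWithBit v true  = fromℕ< (2≤s v) , cong (λ t → not (t ≡ᵇ 0)) (toℕ-fromℕ< (2≤s v))

  Arc : V (VMult G s) → V (VMult G s) → Set
  Arc (x , a) (y , b) = E G x y × (copyBit b ≡ copyBit a xor w x y)

  Arc-isOrientation : IsOrientation (VMult G s) Arc
  Arc-isOrientation =
      (λ { (x , a) (y , b) (e , _) → (λ { refl → E-irrefl e }) , e })
    , (λ { (x , a) (y , b) (_ , e) → oriented x a y b e })
    , (λ { (x , a) (y , b) ((e , ba) , (_ , ab)) →
           ≡-xor⇒≢-xor-not (copyBit a) (copyBit b) (w x y) ba (trans ab (cong (copyBit b xor_) (w-anti e))) })
    where
    ≢-xor⇒≡-xor-not : ∀ a b c → b ≢ a xor c → a ≡ b xor not c
    ≢-xor⇒≡-xor-not true  true  true  ne = refl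
    ≢-xor⇒≡-xor-not true  false false ne = refl
    ≢-xor⇒≡-xor-not false true  false ne = refl
    ≢-xor⇒≡-xor-not false false true  ne = refl
    ≢-xor⇒≡-xor-not true  true  false ne = contradiction refl ne
    ≢-xor⇒≡-xor-not true  false true  ne = contradiction refl ne
    ≢-xor⇒≡-xor-not false true  true  ne = contradiction refl ne
    ≢-xor⇒≡-xor-not false false false ne = contradiction refl ne

    ≡-xor⇒≢-xor-not : ∀ a b c → b ≡ a xor c → a ≢ b xor not c
    ≡-xor⇒≢-xor-not true  _ true  refl ()
    ≡-xor⇒≢-xor-not true  _ false refl ()
    ≡-xor⇒≢-xor-not false _ true  refl ()
    ≡-xor⇒≢-xor-not false _ false refl ()

    oriented : ∀ x a y b → E G x y → Arc (x , a) (y , b) ⊎ Arc (y , b) (x , a)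
    oriented x a y b e with copyBit b Data.Bool.≟ (copyBit a xor w x y)
    ... | yes ba = inj₁ (e , ba)
    ... | no ba  = inj₂ (E-sym e , trans (≢-xor⇒≡-xor-not (copyBit a) (copyBit b) (w x y) ba)
                                         (cong (copyBit b xor_) (sym (w-anti e))))

  lift : ∀ {n π x y} → ParityWalk (suc n) π x y → ∀ a b → copyBit b ≡ copyBit a xor π →
    WalkLe Arc (suc n) (x , a) (y , b)
  lift (_∷_ {x = x} {y} e []) a b ba = step (e , trans ba (cong (copyBit a xor_) (xor-identityʳ (w x y)))) here
  lift (_∷_ {π = π} {x} {y} e W@(_ ∷ _)) a b ba with copyWithBit y (copyBit a xor w x y)
  ... | c , c-bit = step (e , c-bit)
    (lift W c b (trans ba (trans (sym (xor-assoc (copyBit a) (w x y) π)) (cong (_xor π) (sym c-bit)))))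

  InC0-fromParityWalks : (D : ℕ) →
    (∀ x y π → ∃ λ n → suc n ≤ D × ParityWalk (suc n) π x y) →
    (x₀ y₀ : V G) → (∀ k → WalkLe (E G) k x₀ y₀ → D ≤ k) →
    InC0 G s
  InC0-fromParityWalks D walks x₀ y₀ far =
    (λ x y → D , diam-G x y) , 2≤s , D , (diam-G , λ k diam → far k (diam x₀ y₀)) ,
    ((Arc , Arc-isOrientation , (λ u v → D , diam-Arc u v) , diam-Arc) , lower)
    where
    diam-G : DiamLe (E G) D
    diam-G x y with walks x y false
    ... | n , n<D , W = WalkLe-weaken n<D (forget W)

    diam-Arc : DiamLe Arc D
    diam-Arc (x , a) (y , b) with walks x y (copyBit a xor copyBit b)
    ... | n , n<D , W = WalkLe-weaken n<D (lift W a b (sym (xor-cancelˡ (copyBit a) (copyBit b))))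

    lower : (O : V (VMult G s) → V (VMult G s) → Set) → IsOrientation (VMult G s) O → Connected O →
      (k : ℕ) → DiamLe O k → D ≤ k
    lower O O-orientation _ k diam =
      far k (orientation-walk-projects G s O-orientation (diam (x₀ , copy x₀) (y₀ , copy y₀)))
      where
      copy : ∀ v → Fin (s v)
      copy v = proj₁ (copyWithBit v false)

NextC-dec : ∀ k (i j : Fin k) → Dec (NextC k i j)
NextC-dec k i j = (suc (toℕ i) ≟ toℕ j) ⊎-dec ((suc (toℕ i) ≟ k) ×-dec (toℕ j ≟ 0))

NextC-irrefl : ∀ {k} → 2 ≤ k → (i : Fin k) → ¬ NextC k i i
NextC-irrefl 2≤k i (inj₁ i+1≡i) = 1+n≢n i+1≡i
NextC-irrefl 2≤k i (inj₂ (i+1≡k , i≡0)) =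
  <-irrefl refl (≤-trans 2≤k (≤-reflexive (trans (sym i+1≡k) (cong suc i≡0))))

NextC-asym : ∀ {k} → 3 ≤ k → (i j : Fin k) → NextC k i j → ¬ NextC k j i
NextC-asym {k} 3≤k i j = asym k (toℕ i) (toℕ j) 3≤k
  where
  asym : ∀ k a b → 3 ≤ k →
    (suc a ≡ b) ⊎ ((suc a ≡ k) × (b ≡ 0)) → ¬ ((suc b ≡ a) ⊎ ((suc b ≡ k) × (a ≡ 0)))
  asym k a .(suc a) _ (inj₁ refl) (inj₁ a+2≡a) = m≢1+n+m a {1} (sym a+2≡a)
  asym .2 .0 .1 (s≤s (s≤s ())) (inj₁ refl) (inj₂ (refl , refl))
  asym .2 .1 .0 (s≤s (s≤s ())) (inj₂ (refl , refl)) (inj₁ refl)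

δ : ℕ → ℕ → ℕ
δ k n = n ⊓ (k ∸ n)

m∸n≤1+m∸[1+n] : ∀ k a → k ∸ a ≤ suc (k ∸ suc a)
m∸n≤1+m∸[1+n] zero a = ≤-trans (≤-reflexive (0∸n≡0 a)) z≤n
m∸n≤1+m∸[1+n] (suc k) zero = ≤-refl
m∸n≤1+m∸[1+n] (suc k) (suc a) = m∸n≤1+m∸[1+n] k a

δ-next : ∀ k a b → (suc a ≡ b) ⊎ ((suc a ≡ k) × (b ≡ 0)) → (δ k b ≤ suc (δ k a)) × (δ k a ≤ suc (δ k b))
δ-next k a .(suc a) (inj₁ refl) =
  ⊓-mono-≤ (≤-refl {suc a}) (≤-trans (∸-monoʳ-≤ k (n≤1+n a)) (n≤1+n (k ∸ a))) ,
  ⊓-mono-≤ {a} {suc (suc a)} {k ∸ a} {suc (k ∸ suc a)} (≤-trans (n≤1+n a) (n≤1+n _)) (m∸n≤1+m∸[1+n] k a)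
δ-next .(suc a) a .0 (inj₂ (refl , refl)) = z≤n , m≤n⇒o⊓m≤n a (≤-reflexive (m+n∸n≡m 1 a))

δ-step : ∀ k (i j : Fin k) → E (Cycle k) i j → δ k (toℕ j) ≤ suc (δ k (toℕ i))
δ-step k i j (inj₁ i→j) = proj₁ (δ-next k (toℕ i) (toℕ j) i→j)
δ-step k i j (inj₂ j→i) = proj₂ (δ-next k (toℕ j) (toℕ i) j→i)

⌊n/2⌋+⌊n/2⌋≤n : ∀ n → ⌊ n /2⌋ + ⌊ n /2⌋ ≤ n
⌊n/2⌋+⌊n/2⌋≤n zero = z≤n
⌊n/2⌋+⌊n/2⌋≤n (suc zero) = z≤n
⌊n/2⌋+⌊n/2⌋≤n (suc (suc n)) =
  s≤s (≤-trans (≤-reflexive (+-suc ⌊ n /2⌋ ⌊ n /2⌋)) (s≤s (⌊n/2⌋+⌊n/2⌋≤n n)))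

n≤1+⌊n/2⌋+⌊n/2⌋ : ∀ n → n ≤ suc (⌊ n /2⌋ + ⌊ n /2⌋)
n≤1+⌊n/2⌋+⌊n/2⌋ zero = z≤n
n≤1+⌊n/2⌋+⌊n/2⌋ (suc zero) = s≤s z≤n
n≤1+⌊n/2⌋+⌊n/2⌋ (suc (suc n)) =
  s≤s (≤-trans (s≤s (n≤1+⌊n/2⌋+⌊n/2⌋ n)) (s≤s (≤-reflexive (sym (+-suc ⌊ n /2⌋ ⌊ n /2⌋)))))

δ-half : ∀ k → δ k ⌊ k /2⌋ ≡ ⌊ k /2⌋
δ-half k = m≤n⇒m⊓n≡m (m+n≤o⇒m≤o∸n ⌊ k /2⌋ (⌊n/2⌋+⌊n/2⌋≤n k))

half-below : ∀ k .{{_ : NonZero k}} → 2 ≤ ⌊ k /2⌋ → ⌊ k /2⌋ % k ≡ ⌊ k /2⌋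
half-below k 2≤h = m<n⇒m%n≡m (<-≤-trans (m<m+n ⌊ k /2⌋ (≤-trans (n≤1+n 1) 2≤h)) (⌊n/2⌋+⌊n/2⌋≤n k))

routeStart routeEnd : Bool → ℕ → ℕ → ℕ
routeStart true  p a = p
routeStart false p a = a + p
routeEnd   true  p a = a + p
routeEnd   false p a = p

module CyclePositions (k : ℕ) {{_ : NonZero k}} (2≤k : 2 ≤ k) where

  pos : ℕ → Fin k
  pos P = fromℕ< (m%n<n P k)

  toℕ-pos : ∀ P → toℕ (pos P) ≡ P % k
  toℕ-pos P = toℕ-fromℕ< (m%n<n P k)

  pos-toℕ : (x : Fin k) → pos (toℕ x) ≡ x
  pos-toℕ x = toℕ-injective (trans (toℕ-pos (toℕ x)) (m<n⇒m%n≡m (toℕ<n x)))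

  pos-mod : ∀ {P P'} → P % k ≡ P' % k → pos P ≡ pos P'
  pos-mod {P} {P'} P≡P' = toℕ-injective (trans (toℕ-pos P) (trans P≡P' (sym (toℕ-pos P'))))

  +-mod : ∀ a {b c} → b % k ≡ c % k → (a + b) % k ≡ (a + c) % k
  +-mod a {b} {c} b≡c =
    trans (%-distribˡ-+ a b k) (trans (cong (λ t → (a % k + t) % k) b≡c) (sym (%-distribˡ-+ a c k)))

  +k-mod : ∀ P → (k + P) % k ≡ P % k
  +k-mod P = trans (cong (_% k) (+-comm k P)) ([m+n]%n≡m%n P k)

  suc-%-suc : ∀ P → suc P % k ≡ suc (P % k) % k
  suc-%-suc P = trans (%-distribˡ-+ 1 P k) (cong (λ t → (t + P % k) % k) (m<n⇒m%n≡m 2≤k))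

  wrap-around : ∀ P → ¬ suc (P % k) < k → suc (P % k) ≡ k
  wrap-around P P+1≮k = ≤-antisym (m%n<n P k) (≮⇒≥ P+1≮k)

  suc-mod : ∀ P → ((suc (P % k) < k) × (suc P % k ≡ suc (P % k))) ⊎ ((suc (P % k) ≡ k) × (suc P % k ≡ 0))
  suc-mod P with suc (P % k) <? k
  ... | yes P+1<k = inj₁ (P+1<k , trans (suc-%-suc P) (m<n⇒m%n≡m P+1<k))
  ... | no  P+1≮k =
    inj₂ (wrap-around P P+1≮k , trans (suc-%-suc P) (trans (cong (_% k) (wrap-around P P+1≮k)) (n%n≡0 k)))

  pos-next : ∀ P → NextC k (pos P) (pos (suc P))
  pos-next P with suc-mod P
  ... | inj₁ (_ , e) = inj₁ (trans (cong suc (toℕ-pos P)) (sym (trans (toℕ-pos (suc P)) e)))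
  ... | inj₂ (P+1≡k , P+1≡0) = inj₂ (trans (cong suc (toℕ-pos P)) P+1≡k , trans (toℕ-pos (suc P)) P+1≡0)

  mod-offset : ∀ {p r} → p < k → r < k → ∃ λ t → t < k × (t + p) % k ≡ r
  mod-offset {p} {r} p<k r<k with p ≤? r
  ... | yes p≤r = let (t , p+t≡r) = m≤n⇒∃[o]m+o≡n p≤r in
    t , ≤-<-trans (m≤n+m t p) (subst (_< k) (sym p+t≡r) r<k) ,
    trans (cong (_% k) (trans (+-comm t p) p+t≡r)) (m<n⇒m%n≡m r<k)
  ... | no p≰r = let (c , p+c≡k) = m≤n⇒∃[o]m+o≡n (<⇒≤ p<k) in
    c + r , subst (c + r <_) (trans (+-comm c p) p+c≡k) (+-monoʳ-< c (≰⇒> p≰r)) ,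
    (begin
      (c + r + p) % k ≡⟨ cong (_% k) (trans (+-assoc c r p) (trans (cong (c +_) (+-comm r p)) (sym (+-assoc c p r)))) ⟩
      (c + p + r) % k ≡⟨ cong (λ t → (t + r) % k) (trans (+-comm c p) p+c≡k) ⟩
      (k + r) % k     ≡⟨ +k-mod r ⟩
      r % k           ≡⟨ m<n⇒m%n≡m r<k ⟩
      r               ∎)
    where open ≡-Reasoning

  -- A route runs through the positions base, …, length + base, forwards or backwards.
  record Route (x y : Fin k) : Set where
    field
      forward : Bool
      base length : ℕ
      starts : pos (routeStart forward base length) ≡ x
      ends : pos (routeEnd forward base length) ≡ y

  open Route public

  start end : ∀ {x y} → Route x y → ℕ
  start ρ = routeStart (forward ρ) (base ρ) (length ρ)
  end ρ = routeEnd (forward ρ) (base ρ) (length ρ)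

  Crosses : ∀ {x y} → Route x y → ℕ → Set
  Crosses ρ r = ∃ λ i → i < length ρ × (i + base ρ) % k ≡ r

  record RoutePair (x y : Fin k) : Set where
    field
      first second : Route x y
      lengths : length first + length second ≡ k
      crosses : ∀ r → r < k → Crosses first r ⊎ Crosses second r

  open RoutePair public

  swap : ∀ {x y} → RoutePair x y → RoutePair x y
  swap R = record
    { first = second R ; second = first R
    ; lengths = trans (+-comm (length (second R)) (length (first R))) (lengths R)
    ; crosses = λ r r<k → Data.Sum.swap (crosses R r r<k) }

  complementaryRoutes : ∀ {x y} af ab pf pb → af + ab ≡ k → pf < k → pb % k ≡ (af + pf) % k →
    pos pf ≡ x → pos (af + pf) ≡ y → RoutePair x y
  complementaryRoutes {x} {y} af ab pf pb af+ab≡k pf<k pb≡ pf≡x af+pf≡y = record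
    { first = record { forward = true ; base = pf ; length = af ; starts = pf≡x ; ends = af+pf≡y }
    ; second = record
      { forward = false ; base = pb ; length = ab ; starts = back ; ends = trans (pos-mod pb≡) af+pf≡y }
    ; lengths = af+ab≡k
    ; crosses = crosses' }
    where
    open ≡-Reasoning
    back : pos (ab + pb) ≡ x
    back = trans (pos-mod (begin
      (ab + pb) % k        ≡⟨ +-mod ab pb≡ ⟩
      (ab + (af + pf)) % k ≡⟨ cong (_% k) (trans (sym (+-assoc ab af pf)) (cong (_+ pf) (trans (+-comm ab af) af+ab≡k))) ⟩
      (k + pf) % k         ≡⟨ +k-mod pf ⟩
      pf % k               ∎)) pf≡x

    crosses' : ∀ r → r < k → (∃ λ i → i < af × (i + pf) % k ≡ r) ⊎ (∃ λ i → i < ab × (i + pb) % k ≡ r)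
    crosses' r r<k with mod-offset pf<k r<k
    ... | t , t<k , t+pf≡r with t <? af
    ...   | yes t<af = inj₁ (t , t<af , t+pf≡r)
    ...   | no t≮af = let (i , af+i≡t) = m≤n⇒∃[o]m+o≡n (≮⇒≥ t≮af) in
      inj₂ (i , +-cancelˡ-< af i ab (subst (_< af + ab) (sym af+i≡t) (subst (t <_) (sym af+ab≡k) t<k)) ,
        (begin
          (i + pb) % k        ≡⟨ +-mod i pb≡ ⟩
          (i + (af + pf)) % k ≡⟨ cong (_% k) (trans (sym (+-assoc i af pf)) (cong (_+ pf) (trans (+-comm i af) af+i≡t))) ⟩
          (t + pf) % k        ≡⟨ t+pf≡r ⟩
          r                   ∎))

  routePair : (x y : Fin k) → RoutePair x y
  routePair x y with toℕ x ≤? toℕ y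
  ... | yes x≤y =
    let (d , x+d≡y) = m≤n⇒∃[o]m+o≡n x≤y
        (e , d+e≡k) = m≤n⇒∃[o]m+o≡n (≤-trans (m≤n+m d (toℕ x)) (subst (_≤ k) (sym x+d≡y) (<⇒≤ (toℕ<n y)))) in
    complementaryRoutes d e (toℕ x) (toℕ y) d+e≡k (toℕ<n x)
      (cong (_% k) (trans (sym x+d≡y) (+-comm (toℕ x) d))) (pos-toℕ x)
      (trans (cong pos (trans (+-comm d (toℕ x)) x+d≡y)) (pos-toℕ y))
  ... | no x≰y =
    let (d , y+d≡x) = m≤n⇒∃[o]m+o≡n (<⇒≤ (≰⇒> x≰y))
        (e , d+e≡k) = m≤n⇒∃[o]m+o≡n (≤-trans (m≤n+m d (toℕ y)) (subst (_≤ k) (sym y+d≡x) (<⇒≤ (toℕ<n x))))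
        y≡e+x = wrap d y+d≡x e d+e≡k in
    complementaryRoutes e d (toℕ x) (toℕ y) (trans (+-comm e d) d+e≡k) (toℕ<n x) y≡e+x (pos-toℕ x)
      (trans (pos-mod (sym y≡e+x)) (pos-toℕ y))
    where
    wrap : ∀ d → toℕ y + d ≡ toℕ x → ∀ e → d + e ≡ k → toℕ y % k ≡ (e + toℕ x) % k
    wrap d y+d≡x e d+e≡k = sym (begin
      (e + toℕ x) % k       ≡⟨ cong (λ t → (e + t) % k) (sym y+d≡x) ⟩
      (e + (toℕ y + d)) % k ≡⟨ cong (_% k) (trans (+-comm e _) (trans (+-assoc (toℕ y) d e) (cong (toℕ y +_) d+e≡k))) ⟩
      (toℕ y + k) % k       ≡⟨ [m+n]%n≡m%n (toℕ y) k ⟩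
      toℕ y % k             ∎)
      where open ≡-Reasoning

  shortRoutePair : ∀ h → k ≤ suc (h + h) → (x y : Fin k) → ∃ λ (R : RoutePair x y) → length (first R) ≤ h
  shortRoutePair h k≤2h+1 x y with routePair x y
  ... | R with length (first R) ≤? h
  ...   | yes short = R , short
  ...   | no long = swap R , +-cancelˡ-≤ (suc h) _ h (begin
    suc h + length (second R)          ≤⟨ +-monoˡ-≤ _ (≰⇒> long) ⟩
    length (first R) + length (second R) ≡⟨ lengths R ⟩
    k                                  ≤⟨ k≤2h+1 ⟩
    suc h + h                          ∎)
    where open ≤-Reasoning

-- Here a ≤ A and b ≤ B are displacements along two cycles of half-lengths A and B.
nearlyAntipodal⇒1≤ : ∀ {A B a b} → 2 ≤ A → b ≤ B → A + B ≤ suc (a + b) → 1 ≤ a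
nearlyAntipodal⇒1≤ {A} {B} {zero} 2≤A b≤B far =
  contradiction (+-cancelʳ-≤ B A 1 (≤-trans far (s≤s b≤B))) (<⇒≱ 2≤A)
nearlyAntipodal⇒1≤ {a = suc a} _ _ _ = s≤s z≤n

nearlyAntipodal⇒≤ : ∀ {A B a b} → 2 ≤ B → b ≤ 1 → A + B ≤ suc (a + b) → A ≤ a
nearlyAntipodal⇒≤ {A} {B} {a} {b} 2≤B b≤1 far = +-cancelʳ-≤ B A a (begin
  A + B         ≤⟨ far ⟩
  suc (a + b)   ≤⟨ s≤s (+-monoʳ-≤ a b≤1) ⟩
  suc (a + 1)   ≡⟨ sym (+-suc a 1) ⟩
  a + 2         ≤⟨ +-monoʳ-≤ a 2≤B ⟩
  a + B         ∎)
  where open ≤-Reasoning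

complement-≤ : ∀ {h a a' k} → a + a' ≡ k → k ≤ suc (h + h) → h ≤ a → a' ≤ suc h
complement-≤ {h} {a} {a'} a+a'≡k k≤2h+1 h≤a = +-cancelˡ-≤ h a' (suc h) (begin
  h + a'        ≤⟨ +-monoˡ-≤ a' h≤a ⟩
  a + a'        ≡⟨ a+a'≡k ⟩
  _             ≤⟨ k≤2h+1 ⟩
  suc (h + h)   ≡⟨ sym (+-suc h h) ⟩
  h + suc h     ∎)
  where open ≤-Reasoning

complement+1≤ : ∀ {A B a' b} → a' ≤ suc A → b ≤ 1 → 2 ≤ B → a' + b ≤ A + B
complement+1≤ {A} {B} {a'} {b} a'≤A+1 b≤1 2≤B = begin
  a' + b        ≤⟨ +-mono-≤ a'≤A+1 b≤1 ⟩
  suc A + 1     ≡⟨ +-comm (suc A) 1 ⟩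
  suc (suc A)   ≡⟨ +-comm 2 A ⟩
  A + 2         ≤⟨ +-monoʳ-≤ A 2≤B ⟩
  A + B         ∎
  where open ≤-Reasoning

module Torus (L M : ℕ) (4≤M : 4 ≤ M) (M≤L : M ≤ L) where

  4≤L : 4 ≤ L
  4≤L = ≤-trans 4≤M M≤L

  3≤L : 3 ≤ L
  3≤L = ≤-trans (n≤1+n 3) 4≤L

  3≤M : 3 ≤ M
  3≤M = ≤-trans (n≤1+n 3) 4≤M

  2≤L : 2 ≤ L
  2≤L = ≤-trans (n≤1+n 2) 3≤L

  2≤M : 2 ≤ M
  2≤M = ≤-trans (n≤1+n 2) 3≤M

  instance
    L-nonZero : NonZero L
    L-nonZero = >-nonZero (≤-trans (s≤s z≤n) 2≤L)
    M-nonZero : NonZero M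
    M-nonZero = >-nonZero (≤-trans (s≤s z≤n) 2≤M)

  module Hor = CyclePositions L 2≤L
  module Ver = CyclePositions M 2≤M

  G : Graph
  G = Cycle L □ Cycle M

  pt : ℕ → ℕ → V G
  pt P Q = Hor.pos P , Ver.pos Q

  E-sym : ∀ {x y} → E G x y → E G y x
  E-sym (inj₁ (refl , inj₁ j→j')) = inj₁ (refl , inj₂ j→j')
  E-sym (inj₁ (refl , inj₂ j'→j)) = inj₁ (refl , inj₁ j'→j)
  E-sym (inj₂ (inj₁ i→i' , refl)) = inj₂ (inj₂ i→i' , refl)
  E-sym (inj₂ (inj₂ i'→i , refl)) = inj₂ (inj₁ i'→i , refl)

  E-irrefl : ∀ {x} → ¬ E G x x
  E-irrefl {i , j} (inj₁ (_ , inj₁ j→j)) = NextC-irrefl 2≤M j j→j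
  E-irrefl {i , j} (inj₁ (_ , inj₂ j→j)) = NextC-irrefl 2≤M j j→j
  E-irrefl {i , j} (inj₂ (inj₁ i→i , _)) = NextC-irrefl 2≤L i i→i
  E-irrefl {i , j} (inj₂ (inj₂ i→i , _)) = NextC-irrefl 2≤L i i→i

  is1or2 : ℕ → Bool
  is1or2 n = (n ≡ᵇ 1) ∨ (n ≡ᵇ 2)

  -- For even μ the alternating row weights make every unit square odd. For odd μ they fail on the
  -- wrap-around row, and the column weights (nonzero in columns 1 and 2) flip exactly the squares
  -- in columns 0 and 2: a square is odd iff it lies on the wrap-around row exactly when its
  -- column is 0 or 2.
  rowWeight : Fin M → Bool
  rowWeight j = odd (toℕ j)

  columnWeight : Fin L → Bool
  columnWeight i = odd M ∧ is1or2 (toℕ i)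

  weight : V G → V G → Bool
  weight (i , j) (i' , j') with NextC-dec L i i' | NextC-dec L i' i | NextC-dec M j j'
  ... | yes _ | _     | _     = rowWeight j
  ... | no _  | yes _ | _     = not (rowWeight j)
  ... | no _  | no _  | yes _ = columnWeight i
  ... | no _  | no _  | no _  = not (columnWeight i)

  weight-right : ∀ {i i' j j'} → NextC L i i' → weight (i , j) (i' , j') ≡ rowWeight j
  weight-right {i} {i'} i→i' with NextC-dec L i i'
  ... | yes _ = refl
  ... | no ¬i→i' = contradiction i→i' ¬i→i'

  weight-left : ∀ {i i' j j'} → NextC L i' i → weight (i , j) (i' , j') ≡ not (rowWeight j)
  weight-left {i} {i'} i'→i with NextC-dec L i i' | NextC-dec L i' i
  ... | yes i→i' | _     = contradiction i→i' (NextC-asym 3≤L i' i i'→i)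
  ... | no _     | yes _ = refl
  ... | no _     | no ¬i'→i = contradiction i'→i ¬i'→i

  weight-up : ∀ {i j j'} → NextC M j j' → weight (i , j) (i , j') ≡ columnWeight i
  weight-up {i} {j} {j'} j→j' with NextC-dec L i i | NextC-dec M j j'
  ... | yes i→i | _     = contradiction i→i (NextC-irrefl 2≤L i)
  ... | no _    | yes _ = refl
  ... | no _    | no ¬j→j' = contradiction j→j' ¬j→j'

  weight-down : ∀ {i j j'} → NextC M j' j → weight (i , j) (i , j') ≡ not (columnWeight i)
  weight-down {i} {j} {j'} j'→j with NextC-dec L i i | NextC-dec M j j'
  ... | yes i→i | _        = contradiction i→i (NextC-irrefl 2≤L i)
  ... | no _    | yes j→j' = contradiction j→j' (NextC-asym 3≤M j' j j'→j)
  ... | no _    | no _     = refl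

  weight-anti : ∀ {x y} → E G x y → weight y x ≡ not (weight x y)
  weight-anti {i , j} {_ , j'} (inj₁ (refl , inj₁ j→j')) =
    trans (weight-down {i} j→j') (cong not (sym (weight-up {i} j→j')))
  weight-anti {i , j} {_ , j'} (inj₁ (refl , inj₂ j'→j)) =
    trans (weight-up {i} j'→j) (trans (sym (not-involutive _)) (cong not (sym (weight-down {i} j'→j))))
  weight-anti {i , j} {i' , _} (inj₂ (inj₁ i→i' , refl)) =
    trans (weight-left {j = j} {j} i→i') (cong not (sym (weight-right {j = j} {j} i→i')))
  weight-anti {i , j} {i' , _} (inj₂ (inj₂ i'→i , refl)) =
    trans (weight-right {j = j} {j} i'→i)
          (trans (sym (not-involutive _)) (cong not (sym (weight-left {j = j} {j} i'→i))))

  open ParityWalks G weight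
  open Reversal E-sym weight-anti

  rowWeightAt : ℕ → Bool
  rowWeightAt Q = rowWeight (Ver.pos Q)

  columnWeightAt : ℕ → Bool
  columnWeightAt P = columnWeight (Hor.pos P)

  unit : ∀ {x y} → E G x y → ParityWalk 1 (weight x y) x y
  unit {x} {y} e = cast refl (xor-identityʳ (weight x y)) (e ∷ [])

  right : ∀ P Q → ParityWalk 1 (rowWeightAt Q) (pt P Q) (pt (suc P) Q)
  right P Q = cast refl (weight-right {j = Ver.pos Q} {Ver.pos Q} (Hor.pos-next P))
    (unit (inj₂ (inj₁ (Hor.pos-next P) , refl)))

  left : ∀ P Q → ParityWalk 1 (not (rowWeightAt Q)) (pt (suc P) Q) (pt P Q)
  left P Q = cast refl (weight-left {j = Ver.pos Q} {Ver.pos Q} (Hor.pos-next P))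
    (unit (inj₂ (inj₂ (Hor.pos-next P) , refl)))

  up : ∀ P Q → ParityWalk 1 (columnWeightAt P) (pt P Q) (pt P (suc Q))
  up P Q = cast refl (weight-up {Hor.pos P} (Ver.pos-next Q)) (unit (inj₁ (refl , inj₁ (Ver.pos-next Q))))

  down : ∀ P Q → ParityWalk 1 (not (columnWeightAt P)) (pt P (suc Q)) (pt P Q)
  down P Q = cast refl (weight-down {Hor.pos P} (Ver.pos-next Q)) (unit (inj₁ (refl , inj₂ (Ver.pos-next Q))))

  detour : ∀ x → ParityWalk 2 true x x
  detour (i , j) = castEnds pt-toℕ pt-toℕ
    (cast refl (xor-inverseʳ (rowWeightAt (toℕ j))) (right (toℕ i) (toℕ j) ++ left (toℕ i) (toℕ j)))
    where
    pt-toℕ : pt (toℕ i) (toℕ j) ≡ (i , j)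
    pt-toℕ = cong₂ _,_ (Hor.pos-toℕ i) (Ver.pos-toℕ j)

  Segment : ℕ → V G → V G → Set
  Segment n x y = Σ Bool λ π → ParityWalk n π x y

  _++ˢ_ : ∀ {m n x y z} → Segment m x y → Segment n y z → Segment (m + n) x z
  (_ , W) ++ˢ (_ , W') = _ , W ++ W'

  reverseˢ : ∀ {n x y} → Segment n x y → Segment n y x
  reverseˢ (_ , W) = _ , reverse W

  horizontal : ∀ P Q m → Segment m (pt P Q) (pt (m + P) Q)
  horizontal P Q zero = false , []
  horizontal P Q (suc m) with horizontal (suc P) Q m
  ... | _ , W = _ , castEnds refl (cong (λ t → pt t Q) (+-suc m P)) (right P Q ++ W)

  vertical : ∀ P Q m → Segment m (pt P Q) (pt P (m + Q))
  vertical P Q zero = false , []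
  vertical P Q (suc m) with vertical P (suc Q) m
  ... | _ , W = _ , castEnds refl (cong (pt P) (+-suc m Q)) (up P Q ++ W)

  rowFlip : ℕ → Bool
  rowFlip Q = rowWeightAt Q xor rowWeightAt (suc Q)

  columnFlip : ℕ → Bool
  columnFlip P = columnWeightAt P xor columnWeightAt (suc P)

  -- The parity of the weights around the unit square with lower left corner (P, Q).
  flux : ℕ → ℕ → Bool
  flux P Q = rowFlip Q xor columnFlip P

  square : ∀ {P Q} → flux P Q ≡ true → BothParities 2 (pt P Q) (pt (suc P) (suc Q))
  square {P} {Q} odd-flux = BothParities-intro (trans parities odd-flux)
    (right P Q ++ up (suc P) Q) (up P Q ++ right P (suc Q))
    where
    r = rowWeightAt Q ; r' = rowWeightAt (suc Q) ; c = columnWeightAt P ; c' = columnWeightAt (suc P)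
    parities : (r xor c') xor (c xor r') ≡ (r xor r') xor (c xor c')
    parities = begin
      (r xor c') xor (c xor r') ≡⟨ cong ((r xor c') xor_) (xor-comm c r') ⟩
      (r xor c') xor (r' xor c) ≡⟨ interchange r c' r' c ⟩
      (r xor r') xor (c' xor c) ≡⟨ cong ((r xor r') xor_) (xor-comm c' c) ⟩
      (r xor r') xor (c xor c') ∎
      where open ≡-Reasoning

  antisquare : ∀ {P Q} → flux P Q ≡ true → BothParities 2 (pt P (suc Q)) (pt (suc P) Q)
  antisquare {P} {Q} odd-flux = BothParities-intro (trans parities odd-flux)
    (right P (suc Q) ++ down (suc P) Q) (down P Q ++ right P Q)
    where
    r = rowWeightAt Q ; r' = rowWeightAt (suc Q) ; c = columnWeightAt P ; c' = columnWeightAt (suc P)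
    parities : (r' xor not c') xor (not c xor r) ≡ (r xor r') xor (c xor c')
    parities = begin
      (r' xor not c') xor (not c xor r) ≡⟨ cong ((r' xor not c') xor_) (xor-comm (not c) r) ⟩
      (r' xor not c') xor (r xor not c) ≡⟨ interchange r' (not c') r (not c) ⟩
      (r' xor r) xor (not c' xor not c) ≡⟨ cong₂ _xor_ (xor-comm r' r) (xor-annihilates-not c' c) ⟩
      (r xor r') xor (c' xor c)         ≡⟨ cong ((r xor r') xor_) (xor-comm c' c) ⟩
      (r xor r') xor (c xor c')         ∎
      where open ≡-Reasoning

  -- Corner to corner across an a × b rectangle, a = 1 + i + k and b = 1 + j + l, passing the unit
  -- square at offset (i, j) by either of its two sides.
  diagonal : ∀ p q i j k l → flux (i + p) (j + q) ≡ true →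
    BothParities (suc (i + k) + suc (j + l)) (pt p q) (pt (suc (i + k) + p) (suc (j + l) + q))
  diagonal p q i j k l odd-flux π = cast (shuffle-length i j k l) refl
    (castEnds refl (cong₂ pt (shuffle-end k i p) (shuffle-end l j q))
      (prepend (proj₂ (horizontal p q i ++ˢ vertical (i + p) q j))
        (append (square odd-flux)
          (proj₂ (horizontal (suc (i + p)) (suc (j + q)) k ++ˢ vertical (k + suc (i + p)) (suc (j + q)) l))) π))
    where
    shuffle-length : ∀ i j k l → (i + j) + (2 + (k + l)) ≡ suc (i + k) + suc (j + l)
    shuffle-length = solve-∀
    shuffle-end : ∀ k i p → k + suc (i + p) ≡ suc (i + k) + p
    shuffle-end = solve-∀

  antidiagonal : ∀ p q i j k l → flux (i + p) (j + q) ≡ true →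
    BothParities (suc (i + k) + suc (j + l)) (pt p (suc (j + l) + q)) (pt (suc (i + k) + p) q)
  antidiagonal p q i j k l odd-flux π = cast (shuffle-length i j k l) refl
    (castEnds (cong (pt p) (shuffle-end l j q)) (cong (λ t → pt t q) (shuffle-end k i p))
      (prepend (proj₂ (horizontal p (l + suc (j + q)) i ++ˢ reverseˢ (vertical (i + p) (suc (j + q)) l)))
        (append (antisquare odd-flux)
          (proj₂ (horizontal (suc (i + p)) (j + q) k ++ˢ reverseˢ (vertical (k + suc (i + p)) q j)))) π))
    where
    shuffle-length : ∀ i j k l → (i + l) + (2 + (k + j)) ≡ suc (i + k) + suc (j + l)
    shuffle-length = solve-∀
    shuffle-end : ∀ k i p → k + suc (i + p) ≡ suc (i + k) + p
    shuffle-end = solve-∀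

  path-corners : ∀ hf vf p a q b →
    Segment (a + b) (pt (routeStart hf p a) (routeStart vf q b)) (pt (routeEnd hf p a) (routeEnd vf q b))
  path-corners true  true  p a q b = horizontal p q a ++ˢ vertical (a + p) q b
  path-corners true  false p a q b = horizontal p (b + q) a ++ˢ reverseˢ (vertical (a + p) q b)
  path-corners false true  p a q b = reverseˢ (horizontal p q a) ++ˢ vertical p q b
  path-corners false false p a q b = reverseˢ (horizontal p (b + q) a) ++ˢ reverseˢ (vertical p q b)

  rectangle-corners : ∀ hf vf p a q b {i j} → i < a → j < b → flux (i + p) (j + q) ≡ true →
    BothParities (a + b) (pt (routeStart hf p a) (routeStart vf q b)) (pt (routeEnd hf p a) (routeEnd vf q b))
  rectangle-corners hf vf p a q b i<a j<b odd-flux with m≤n⇒∃[o]m+o≡n i<a | m≤n⇒∃[o]m+o≡n j<b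
  rectangle-corners true  true  p _ q _ {i} {j} _ _ odd-flux | k , refl | l , refl =
    diagonal p q i j k l odd-flux
  rectangle-corners true  false p _ q _ {i} {j} _ _ odd-flux | k , refl | l , refl =
    antidiagonal p q i j k l odd-flux
  rectangle-corners false true  p _ q _ {i} {j} _ _ odd-flux | k , refl | l , refl =
    reverse-both (antidiagonal p q i j k l odd-flux)
  rectangle-corners false false p _ q _ {i} {j} _ _ odd-flux | k , refl | l , refl =
    reverse-both (diagonal p q i j k l odd-flux)

  module _ {x₀ x₁ y₀ y₁} (ρ : Hor.Route x₀ x₁) (σ : Ver.Route y₀ y₁) where
    open Hor using (forward; base; length)
    open Ver using () renaming (forward to forward′; base to base′; length to length′)

    along : ∀ {n π} → ParityWalk n π (pt (Hor.start ρ) (Ver.start σ)) (pt (Hor.end ρ) (Ver.end σ)) →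
      ParityWalk n π (x₀ , y₀) (x₁ , y₁)
    along = castEnds (cong₂ _,_ (Hor.starts ρ) (Ver.starts σ)) (cong₂ _,_ (Hor.ends ρ) (Ver.ends σ))

    routes-segment : Segment (length ρ + length′ σ) (x₀ , y₀) (x₁ , y₁)
    routes-segment with path-corners (forward ρ) (forward′ σ) (base ρ) (length ρ) (base′ σ) (length′ σ)
    ... | _ , W = _ , along W

    routes-square : ∀ {i j} → i < length ρ → j < length′ σ → flux (i + base ρ) (j + base′ σ) ≡ true →
      BothParities (length ρ + length′ σ) (x₀ , y₀) (x₁ , y₁)
    routes-square i<a j<b odd-flux π =
      along (rectangle-corners (forward ρ) (forward′ σ) (base ρ) (length ρ) (base′ σ) (length′ σ) i<a j<b odd-flux π)

  is0or2 : ℕ → Bool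
  is0or2 n = (n ≡ᵇ 0) ∨ (n ≡ᵇ 2)

  rowWeightAt-mod : ∀ Q → rowWeightAt Q ≡ odd (Q % M)
  rowWeightAt-mod Q = cong odd (Ver.toℕ-pos Q)

  rowFlip-inner : ∀ {Q} → suc (Q % M) < M → rowFlip Q ≡ true
  rowFlip-inner {Q} inner with Ver.suc-mod Q
  ... | inj₁ (_ , Q+1≡) =
    trans (cong₂ _xor_ (rowWeightAt-mod Q) (trans (rowWeightAt-mod (suc Q)) (cong odd Q+1≡))) (xor-inverseʳ (odd (Q % M)))
  ... | inj₂ (wrap , _) = contradiction wrap (<⇒≢ inner)

  rowFlip-wrap : ∀ {Q} → suc (Q % M) ≡ M → rowFlip Q ≡ not (odd M)
  rowFlip-wrap {Q} wrap with Ver.suc-mod Q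
  ... | inj₁ (inner , _) = contradiction wrap (<⇒≢ inner)
  ... | inj₂ (_ , Q+1≡0) = begin
    rowFlip Q               ≡⟨ cong₂ _xor_ (rowWeightAt-mod Q) (trans (rowWeightAt-mod (suc Q)) (cong odd Q+1≡0)) ⟩
    odd (Q % M) xor false   ≡⟨ xor-identityʳ _ ⟩
    odd (Q % M)             ≡⟨ sym (not-involutive _) ⟩
    not (odd (suc (Q % M))) ≡⟨ cong (not ∘ odd) wrap ⟩
    not (odd M)             ∎
    where open ≡-Reasoning

  rowFlip-even : odd M ≡ false → ∀ Q → rowFlip Q ≡ true
  rowFlip-even M-even Q with suc (Q % M) <? M
  ... | yes inner = rowFlip-inner inner
  ... | no ¬inner = trans (rowFlip-wrap (Ver.wrap-around Q ¬inner)) (cong not M-even)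

  rowFlip-wrap-odd : odd M ≡ true → ∀ {Q} → suc (Q % M) ≡ M → rowFlip Q ≡ false
  rowFlip-wrap-odd M-odd wrap = trans (rowFlip-wrap wrap) (cong not M-odd)

  columnFlip-even : odd M ≡ false → ∀ P → columnFlip P ≡ false
  columnFlip-even M-even P = cong₂ _xor_ (zero-weight P) (zero-weight (suc P))
    where
    zero-weight : ∀ P → columnWeightAt P ≡ false
    zero-weight P = cong (_∧ is1or2 (toℕ (Hor.pos P))) M-even

  columnWeightAt-odd : odd M ≡ true → ∀ P → columnWeightAt P ≡ is1or2 (P % L)
  columnWeightAt-odd M-odd P = cong₂ _∧_ M-odd (cong is1or2 (Hor.toℕ-pos P))

  columnFlip-odd : odd M ≡ true → ∀ P → columnFlip P ≡ is0or2 (P % L)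
  columnFlip-odd M-odd P with Hor.suc-mod P
  ... | inj₁ (_ , P+1≡) =
    trans (cong₂ _xor_ (columnWeightAt-odd M-odd P) (trans (columnWeightAt-odd M-odd (suc P)) (cong is1or2 P+1≡)))
          (boundary (P % L))
    where
    boundary : ∀ r → is1or2 r xor is1or2 (suc r) ≡ is0or2 r
    boundary 0 = refl
    boundary 1 = refl
    boundary 2 = refl
    boundary (suc (suc (suc r))) = refl
  ... | inj₂ (wrap , P+1≡0) =
    trans (cong₂ _xor_ (columnWeightAt-odd M-odd P) (trans (columnWeightAt-odd M-odd (suc P)) (cong is1or2 P+1≡0)))
          (last (P % L) (≤-trans 4≤L (≤-reflexive (sym wrap))))
    where
    last : ∀ r → 4 ≤ suc r → is1or2 r xor false ≡ is0or2 r
    last (suc (suc (suc r))) _ = refl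
    last 0 (s≤s ())
    last 1 (s≤s (s≤s ()))
    last 2 (s≤s (s≤s (s≤s ())))

  flux-even : odd M ≡ false → ∀ P Q → flux P Q ≡ true
  flux-even M-even P Q = cong₂ _xor_ (rowFlip-even M-even Q) (columnFlip-even M-even P)

  flux-odd : ∀ {P Q β} → odd M ≡ true → rowFlip Q ≡ β → is0or2 (P % L) ≡ not β → flux P Q ≡ true
  flux-odd {P} {Q} {β} M-odd row column =
    trans (cong₂ _xor_ row (trans (columnFlip-odd M-odd P) column)) (xor-inverseʳ β)

  innerRow : ∀ q {b} → 2 ≤ b → ∃ λ j → j < b × rowFlip (j + q) ≡ true
  innerRow q 2≤b with suc (q % M) <? M
  ... | yes inner = 0 , ≤-trans (n≤1+n 1) 2≤b , rowFlip-inner inner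
  ... | no ¬inner = 1 , 2≤b , rowFlip-inner next-inner
    where
    next-inner : suc (suc q % M) < M
    next-inner with Ver.suc-mod q
    ... | inj₁ (inner , _) = contradiction inner ¬inner
    ... | inj₂ (_ , q+1≡0) = subst (λ t → suc t < M) (sym q+1≡0) 2≤M

  ordinaryColumn : ∀ p {a} → 2 ≤ a → ∃ λ i → i < a × is0or2 ((i + p) % L) ≡ false
  ordinaryColumn p 2≤a with is0or2 (p % L) in special
  ... | false = 0 , ≤-trans (n≤1+n 1) 2≤a , special
  ... | true  = 1 , 2≤a , next-ordinary
    where
    next-ordinary : is0or2 (suc p % L) ≡ false
    next-ordinary with Hor.suc-mod p
    ... | inj₁ (_ , p+1≡) = trans (cong is0or2 p+1≡) (after (p % L) special)
      where
      after : ∀ r → is0or2 r ≡ true → is0or2 (suc r) ≡ false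
      after 0 _ = refl
      after 2 _ = refl
    ... | inj₂ (wrap , _) = contradiction (≤-trans 4≤L (≤-reflexive (sym wrap))) (small (p % L) special)
      where
      small : ∀ r → is0or2 r ≡ true → ¬ 4 ≤ suc r
      small 0 _ (s≤s ())
      small 2 _ (s≤s (s≤s (s≤s ())))

  A B D : ℕ
  A = ⌊ L /2⌋
  B = ⌊ M /2⌋
  D = A + B

  2≤A : 2 ≤ A
  2≤A = ⌊n/2⌋-mono 4≤L

  2≤B : 2 ≤ B
  2≤B = ⌊n/2⌋-mono 4≤M

  L≤2A+1 : L ≤ suc (A + A)
  L≤2A+1 = n≤1+⌊n/2⌋+⌊n/2⌋ L

  M≤2B+1 : M ≤ suc (B + B)
  M≤2B+1 = n≤1+⌊n/2⌋+⌊n/2⌋ M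

  ShortWalk : Bool → V G → V G → Set
  ShortWalk π x y = ∃ λ n → suc n ≤ D × ParityWalk (suc n) π x y

  short-both : ∀ {n x y} → BothParities n x y → 1 ≤ n → n ≤ D → ∀ π → ShortWalk π x y
  short-both {suc n} both _ n<D π = n , n<D , both π

  short-detour : ∀ {n π₀ x y} → ParityWalk n π₀ x y → 2 + n ≤ D → ∀ π → ShortWalk π x y
  short-detour {n} {π₀} W fits π with π₀ Data.Bool.≟ π
  short-detour {suc n} W fits π | yes refl = n , ≤-trans (n≤1+n _) (≤-trans (n≤1+n _) fits) , W
  short-detour {zero} {x = x} {y} W fits π | yes refl =
    3 , +-mono-≤ 2≤A 2≤B , cast refl (xor-identityʳ π) (W ++ detour y ++ detour y)
  short-detour {n} {x = x} W fits π | no π₀≢π =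
    suc n , fits , cast refl (sym (¬-not (π₀≢π ∘ sym))) (detour x ++ W)

  routes-square-short : ∀ {x₀ x₁ y₀ y₁ i j} (ρ : Hor.Route x₀ x₁) (σ : Ver.Route y₀ y₁) →
    i < Hor.length ρ → j < Ver.length σ → flux (i + Hor.base ρ) (j + Ver.base σ) ≡ true →
    Hor.length ρ + Ver.length σ ≤ D → ∀ π → ShortWalk π (x₀ , y₀) (x₁ , y₁)
  routes-square-short ρ σ i<a j<b odd-flux fits =
    short-both (routes-square ρ σ i<a j<b odd-flux) (≤-trans (s≤s z≤n) (≤-trans i<a (m≤m+n _ _))) fits

  module _ {x₀ x₁ y₀ y₁} (R : Hor.RoutePair x₀ x₁) (S : Ver.RoutePair y₀ y₁)
           (a≤A : Hor.length (Hor.first R) ≤ A) (b≤B : Ver.length (Ver.first S) ≤ B) where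
    ρ = Hor.first R
    σ = Ver.first S
    a = Hor.length ρ
    b = Ver.length σ
    p = Hor.base ρ
    q = Ver.base σ

    walks-near : 2 + (a + b) ≤ D → ∀ π → ShortWalk π (x₀ , y₀) (x₁ , y₁)
    walks-near = short-detour (proj₂ (routes-segment ρ σ))

    module Far (far : D ≤ suc (a + b)) where
      far′ : B + A ≤ suc (b + a)
      far′ = subst₂ (λ s t → s ≤ suc t) (+-comm A B) (+-comm a b) far

      1≤a : 1 ≤ a
      1≤a = nearlyAntipodal⇒1≤ 2≤A b≤B far

      1≤b : 1 ≤ b
      1≤b = nearlyAntipodal⇒1≤ 2≤B a≤A far′

      a+b≤D : a + b ≤ D
      a+b≤D = +-mono-≤ a≤A b≤B

      long-horizontal-fits : b ≤ 1 → Hor.length (Hor.second R) + b ≤ D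
      long-horizontal-fits b≤1 =
        complement+1≤ (complement-≤ (Hor.lengths R) L≤2A+1 (nearlyAntipodal⇒≤ 2≤B b≤1 far)) b≤1 2≤B

      long-vertical-fits : a ≤ 1 → a + Ver.length (Ver.second S) ≤ D
      long-vertical-fits a≤1 = subst₂ _≤_ (+-comm _ a) (+-comm B A)
        (complement+1≤ (complement-≤ (Ver.lengths S) M≤2B+1 (nearlyAntipodal⇒≤ 2≤A a≤1 far′)) a≤1 2≤A)

      -- With a single row of squares lying on the wrap-around row, an odd square needs a column
      -- in {0, 2}; if the short horizontal route misses column 0, the long one has room for it.
      thin : odd M ≡ true → b ≤ 1 → ∀ π → ShortWalk π (x₀ , y₀) (x₁ , y₁)
      thin M-odd b≤1 with ordinaryColumn p (≤-trans 2≤A (nearlyAntipodal⇒≤ 2≤B b≤1 far)) | suc (q % M) <? M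
      ... | i , i<a , ordinary | yes inner =
        routes-square-short ρ σ i<a 1≤b (flux-odd M-odd (rowFlip-inner inner) ordinary) a+b≤D
      ... | _ | no outer with Hor.crosses R 0 (≤-trans (s≤s z≤n) 2≤L)
      ...   | inj₁ (i , i<a , at0) = routes-square-short ρ σ i<a 1≤b
                (flux-odd M-odd (rowFlip-wrap-odd M-odd (Ver.wrap-around q outer)) (cong is0or2 at0)) a+b≤D
      ...   | inj₂ (i , i<a' , at0) = routes-square-short (Hor.second R) σ i<a' 1≤b
                (flux-odd M-odd (rowFlip-wrap-odd M-odd (Ver.wrap-around q outer)) (cong is0or2 at0))
                (long-horizontal-fits b≤1)

      narrow : odd M ≡ true → a ≤ 1 → 2 ≤ b → ∀ π → ShortWalk π (x₀ , y₀) (x₁ , y₁)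
      narrow M-odd a≤1 2≤b with is0or2 (p % L) in special
      ... | false = let (j , j<b , inner) = innerRow q 2≤b in
        routes-square-short ρ σ 1≤a j<b (flux-odd M-odd inner special) a+b≤D
      ... | true with Ver.crosses S (pred M) (≤-reflexive (suc-pred M))
      ...   | inj₁ (j , j<b , at-wrap) = routes-square-short ρ σ 1≤a j<b
                (flux-odd M-odd (rowFlip-wrap-odd M-odd (trans (cong suc at-wrap) (suc-pred M))) special) a+b≤D
      ...   | inj₂ (j , j<b' , at-wrap) = routes-square-short ρ (Ver.second S) 1≤a j<b'
                (flux-odd M-odd (rowFlip-wrap-odd M-odd (trans (cong suc at-wrap) (suc-pred M))) special)
                (long-vertical-fits a≤1)

      walks-far : ∀ π → ShortWalk π (x₀ , y₀) (x₁ , y₁)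
      walks-far with odd M in M-parity
      ... | false = routes-square-short ρ σ 1≤a 1≤b (flux-even M-parity p q) a+b≤D
      ... | true with 2 ≤? b | 2 ≤? a
      ...   | no b≱2 | _ = thin M-parity (≤-pred (≰⇒> b≱2))
      ...   | yes 2≤b | no a≱2 = narrow M-parity (≤-pred (≰⇒> a≱2)) 2≤b
      ...   | yes 2≤b | yes 2≤a =
        let (i , i<a , ordinary) = ordinaryColumn p 2≤a
            (j , j<b , inner) = innerRow q 2≤b in
        routes-square-short ρ σ i<a j<b (flux-odd M-parity inner ordinary) a+b≤D

  parityWalks : ∀ x y π → ShortWalk π x y
  parityWalks (x₀ , y₀) (x₁ , y₁) with Hor.shortRoutePair A L≤2A+1 x₀ x₁ | Ver.shortRoutePair B M≤2B+1 y₀ y₁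
  ... | R , a≤A | S , b≤B with 2 + (Hor.length (Hor.first R) + Ver.length (Ver.first S)) ≤? D
  ...   | yes near = walks-near R S a≤A b≤B near
  ...   | no ¬near = Far.walks-far R S a≤A b≤B (≤-pred (≰⇒> ¬near))

  corners-far : ∀ k → WalkLe (E G) k (pt 0 0) (pt A B) → D ≤ k
  corners-far k W = begin
    D              ≡⟨ sym φ-end ⟩
    φ (pt A B)     ≤⟨ WalkLe-potential φ φ-step W ⟩
    k + φ (pt 0 0) ≡⟨ cong (k +_) φ-start ⟩
    k + 0          ≡⟨ +-identityʳ k ⟩
    k              ∎
    where
    open ≤-Reasoning
    φ : V G → ℕ
    φ (i , j) = δ L (toℕ i) + δ M (toℕ j)

    φ-step : ∀ {x y} → E G x y → φ y ≤ suc (φ x)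
    φ-step {i , j} (inj₁ (refl , j-j')) =
      ≤-trans (+-monoʳ-≤ (δ L (toℕ i)) (δ-step M _ _ j-j')) (≤-reflexive (+-suc _ _))
    φ-step {i , j} (inj₂ (i-i' , refl)) = +-monoˡ-≤ (δ M (toℕ j)) (δ-step L _ _ i-i')

    φ-start : φ (pt 0 0) ≡ 0
    φ-start = cong₂ (λ m n → δ L m + δ M n)
      (trans (Hor.toℕ-pos 0) (m<n⇒m%n≡m (≤-trans (s≤s z≤n) 2≤L)))
      (trans (Ver.toℕ-pos 0) (m<n⇒m%n≡m (≤-trans (s≤s z≤n) 2≤M)))

    φ-end : φ (pt A B) ≡ D
    φ-end = cong₂ _+_ (trans (cong (δ L) (trans (Hor.toℕ-pos A) (half-below L 2≤A))) (δ-half L))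
                      (trans (cong (δ M) (trans (Ver.toℕ-pos B) (half-below M 2≤B))) (δ-half M))

proposition5p1 : (λ' μ : ℕ) → 4 ≤ μ → μ ≤ λ' →
    (s : Fin λ' × Fin μ → ℕ) → ((v : Fin λ' × Fin μ) → 2 ≤ s v) →
    InC0 (Cycle λ' □ Cycle μ) s
proposition5p1 λ' μ 4≤μ μ≤λ' s 2≤s =
  InC0-fromParityWalks D parityWalks (pt 0 0) (pt A B) corners-far
  where
  open Torus λ' μ 4≤μ μ≤λ'
  open ParityOrientation G weight E-sym E-irrefl weight-anti s 2≤s
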